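{- Let $\mathfrak A$ be a generalized model (in the narrow sense) with universe $\beta X$. Then for every first-order formula $\varphi(x_1,\dots,x_n)$ and all $\mathfrak u_1,\dots,\mathfrak u_n\in\beta X$: $\mathfrak A\Vdash\varphi[\mathfrak u_1,\dots,\mathfrak u_n]$ if and only if $e(\mathfrak A)\models\varphi[\mathfrak u_1,\dots,\mathfrak u_n]$.
   Context: For a set $Z$, $\beta Z$ is the set of ultrafilters on $Z$, with $Z\subseteq\beta Z$ via principal ultrafilters and the standard compact Hausdorff topology with base $\{\mathfrak u:A\in\mathfrak u\}$. $(\forall^{\mathfrak u}z)\varphi(z)$ means $\{z:\varphi(z)\}\in\mathfrak u$. Fix a first-order signature and a set $X$. A generalized model in the narrow sense $\mathfrak A$ with universe $\beta X$ is given by an interpretation $\imath$ assigning to each $n$-ary functional symbol $F$ an ultrafilter $\imath(F)\in\beta(X^{X^n})$ and to each $n$-ary predicate symbol $R$ an ultrafilter $\imath(R)\in\beta\,\mathcal P(X^n)$. Define $\widetilde{\mathrm{app}}(\mathfrak u_1,\dots,\mathfrak u_n,\mathfrak f)=\{A\subseteq X:(\forall^{\mathfrak u_1}x_1)\cdots(\forall^{\mathfrak u_n}x_n)(\forall^{\mathfrak f}f)\,f(x_1,\dots,x_n)\in A\}$ and $\widetilde{\mathrm{in}}(\mathfrak u_1,\dots,\mathfrak u_n,\mathfrak r)$ iff $(\forall^{\mathfrak u_1}x_1)\cdots(\forall^{\mathfrak u_n}x_n)(\forall^{\mathfrak r}Q)\,(x_1,\dots,x_n)\in Q$. For a valuation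 $v$ of variables in $\beta X$, extend to terms by $v_\imath(x)=v(x)$, $v_\imath(F(t_1,\dots,t_n))=\widetilde{\mathrm{app}}(v_\imath(t_1),\dots,v_\imath(t_n),\imath(F))$. Satisfaction: $\mathfrak A\Vdash t_1=t_2[v]$ iff $v_\imath(t_1)=v_\imath(t_2)$; $\mathfrak A\Vdash R(t_1,\dots,t_n)[v]$ iff $\widetilde{\mathrm{in}}(v_\imath(t_1),\dots,v_\imath(t_n),\imath(R))$; negation, conjunction and quantifiers (ranging over $\beta X$) as usual. The ordinary model $e(\mathfrak A)=(\beta X,e(\imath(F)),\dots,e(\imath(R)),\dots)$ is defined as follows. Let $\mathrm{RC}_n$ be the set of maps $g:(\beta X)^n\to\beta X$ right continuous w.r.t. $X$ (for each $i$, all $a_1,\dots,a_{i-1}\in X$ and $\mathfrak u_{i+1},\dots,\mathfrak u_n\in\beta X$, $\mathfrak u\mapsto g(a_1,\dots,a_{i-1},\mathfrak u,\mathfrak u_{i+1},\dots,\mathfrak u_n)$ is continuous), with the topology with subbase $\{g:g(a)\in U\}$, $a\in X^n$, $U\subseteq\beta X$ open (a compact Hausdorff space). For $f:X^n\to X$, $\tilde f(\mathfrak u_1,\dots,\mathfrak u_n)=\{A:(\forall^{\mathfrak u_1}x_1)\cdots(\forall^{\mathfrak u_n}x_n)f(x_1,\dots,x_n)\in A\}\in\mathrm{RC}_n$, and $e:\beta(X^{X^n})\to\mathrm{RC}_n$ is the unique continuous extension of $f\mapsto\tilde f$ ($X^{X^n}$ discrete). For relations, identify $Q\subseteq X^n$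 with its characteristic function into the discrete space $\{0,1\}$ and define $e:\beta\,\mathcal P(X^n)\to\mathcal P((\beta X)^n)$ by the same construction (the extension of $Q$ being $\tilde Q=\{(\mathfrak u_1,\dots,\mathfrak u_n):(\forall^{\mathfrak u_1}x_1)\cdots(\forall^{\mathfrak u_n}x_n)(x_1,\dots,x_n)\in Q\}$). -}

module Defs where

open import Data.Nat using (ℕ; _≟_)
open import Data.Bool using (Bool; true; false; _∧_; not)
open import Data.Fin using (Fin; zero; suc; _<?_)
open import Data.Fin.Properties renaming (_≟_ to _≟ᶠ_)
open import Data.Product using (Σ; _×_; _,_)
open import Data.Sum using (_⊎_; inj₁; inj₂)
open import Data.Empty using (⊥)
open import Relation.Nullary using (¬_; yes; no)
open import Relation.Binary.PropositionalEquality using (_≡_; refl)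

-- Subsets of Z are represented by characteristic functions Z → Bool.
-- Ultrafilters on Z (points of βZ).

record UF (Z : Set) : Set where
  field
    mem     : (Z → Bool) → Bool
    upward  : ∀ (A B : Z → Bool) → (∀ z → A z ≡ true → B z ≡ true) →
              mem A ≡ true → mem B ≡ true
    inter   : ∀ (A B : Z → Bool) → mem A ≡ true → mem B ≡ true →
              mem (λ z → A z ∧ B z) ≡ true
    proper  : mem (λ _ → false) ≡ false
    ultra   : ∀ (A : Z → Bool) → mem A ≡ true ⊎ mem (λ z → not (A z)) ≡ true

open UF public

_≈_ : {Z : Set} → UF Z → UF Z → Set
u ≈ w = ∀ A → mem u A ≡ mem w A

principal : {Z : Set} → Z → UF Z
principal z = record
  { mem = λ A → A z
  ; upward = λ A B h p → h z p
  ; inter = λ A B p q → lem p q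
  ; proper = refl
  ; ultra = λ A → ult (A z)
  }
  where
  lem : ∀ {a b : Bool} → a ≡ true → b ≡ true → a ∧ b ≡ true
  lem refl refl = refl
  ult : ∀ (b : Bool) → b ≡ true ⊎ not b ≡ true
  ult true = inj₁ refl
  ult false = inj₂ refl

IsOpen : {Z : Set} → (UF Z → Set) → Set
IsOpen {Z} U = ∀ u → U u →
  Σ (Z → Bool) λ A → (mem u A ≡ true) × (∀ w → mem w A ≡ true → U w)

cons : {A : Set} {n : ℕ} → A → (Fin n → A) → Fin (ℕ.suc n) → A
cons a as zero = a
cons a as (suc i) = as i

-- iterated quantifier (∀^{u_1} x_1) ⋯ (∀^{u_n} x_n) P(x_1,…,x_n),
-- for "set-of-subsets" functions (X → Bool) → Bool
iterM : {X : Set} (n : ℕ) → (Fin n → ((X → Bool) → Bool)) →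
        ((Fin n → X) → Bool) → Bool
iterM ℕ.zero us P = P (λ ())
iterM (ℕ.suc n) us P =
  us zero (λ x → iterM n (λ i → us (suc i)) (λ xs → P (cons x xs)))

iter : {X : Set} (n : ℕ) → (Fin n → UF X) → ((Fin n → X) → Bool) → Bool
iter n us = iterM n (λ i → mem (us i))

mix : {X : Set} {n : ℕ} → Fin n → (Fin n → X) → (Fin n → UF X) → UF X →
      Fin n → UF X
mix i a ws u j with j <? i
... | yes _ = principal (a j)
... | no _ with j ≟ᶠ i
...   | yes _ = u
...   | no _ = ws j

RightCont : {X : Set} {n : ℕ} → ((Fin n → UF X) → UF X) → Set₁
RightCont {X} {n} g = ∀ (i : Fin n) (a : Fin n → X) (ws : Fin n → UF X)
  (U : UF X → Set) → IsOpen U → IsOpen (λ u → U (g (mix i a ws u)))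

RightContRel : {X : Set} {n : ℕ} → ((Fin n → UF X) → Bool) → Set₁
RightContRel {X} {n} g = ∀ (i : Fin n) (a : Fin n → X) (ws : Fin n → UF X)
  (U : Bool → Set) → IsOpen (λ u → U (g (mix i a ws u)))

FunSp : Set → ℕ → Set
FunSp X n = (Fin n → X) → X

RelSp : Set → ℕ → Set
RelSp X n = (Fin n → X) → Bool

-- E is the continuous extension e : β(X^{X^n}) → RC_n of f ↦ f̃
record IsFunExt (X : Set) (n : ℕ)
    (E : UF (FunSp X n) → (Fin n → UF X) → UF X) : Set₁ where
  field
    resp-arg : ∀ 𝔣 us ws → (∀ i → us i ≈ ws i) → E 𝔣 us ≈ E 𝔣 ws
    resp-uf  : ∀ 𝔣 𝔤 → 𝔣 ≈ 𝔤 → ∀ us → E 𝔣 us ≈ E 𝔤 us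
    rc       : ∀ 𝔣 → RightCont (E 𝔣)
    cont     : ∀ (a : Fin n → X) (U : UF X → Set) → IsOpen U →
               IsOpen (λ 𝔣 → U (E 𝔣 (λ i → principal (a i))))
    extends  : ∀ (f : FunSp X n) us A →
               mem (E (principal f) us) A ≡ iter n us (λ xs → A (f xs))

-- E is the continuous extension e : β P(X^n) → P((βX)^n) of Q ↦ Q̃
-- (values in β{0,1} identified with {0,1} = Bool)
record IsRelExt (X : Set) (n : ℕ)
    (E : UF (RelSp X n) → (Fin n → UF X) → Bool) : Set₁ where
  field
    resp-arg : ∀ 𝔯 us ws → (∀ i → us i ≈ ws i) → E 𝔯 us ≡ E 𝔯 ws
    resp-uf  : ∀ 𝔯 𝔰 → 𝔯 ≈ 𝔰 → ∀ us → E 𝔯 us ≡ E 𝔰 us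
    rc       : ∀ 𝔯 → RightContRel (E 𝔯)
    cont     : ∀ (a : Fin n → X) (U : Bool → Set) →
               IsOpen (λ 𝔯 → U (E 𝔯 (λ i → principal (a i))))
    extends  : ∀ (Q : RelSp X n) us → E (principal Q) us ≡ iter n us Q

record Signature : Set₁ where
  field
    FunSym  : Set
    RelSym  : Set
    farity  : FunSym → ℕ
    rarity  : RelSym → ℕ

open Signature public

module _ (σ : Signature) where

  data Term : Set where
    var : ℕ → Term
    app : (F : FunSym σ) → (Fin (farity σ F) → Term) → Term

  data Formula : Set where
    _≐_  : Term → Term → Formula
    rel  : (R : RelSym σ) → (Fin (rarity σ R) → Term) → Formula
    ¬'_  : Formula → Formula
    _∧'_ : Formula → Formula → Formula
    ∀'   : ℕ → Formula → Formula
    ∃'   : ℕ → Formula → Formula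

record Interp (σ : Signature) (X : Set) : Set where
  field
    iF : (F : FunSym σ) → UF (FunSp X (farity σ F))
    iR : (R : RelSym σ) → UF (RelSp X (rarity σ R))

open Interp public

update : {A : Set} → (ℕ → A) → ℕ → A → ℕ → A
update v x a y with y ≟ x
... | yes _ = a
... | no _ = v y

module Semantics {σ : Signature} {X : Set} (ι : Interp σ X) where

  gval : (ℕ → UF X) → Term σ → (X → Bool) → Bool
  gval v (var x) = mem (v x)
  gval v (app F ts) A =
    iterM (farity σ F) (λ i → gval v (ts i))
      (λ xs → mem (iF ι F) (λ f → A (f xs)))

  GSat : Formula σ → (ℕ → UF X) → Set
  GSat (t₁ ≐ t₂) v = (∀ A → gval v t₁ A ≡ gval v t₂ A)
  GSat (rel R ts) v =
    (iterM (rarity σ R) (λ i → gval v (ts i))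
       (λ xs → mem (iR ι R) (λ Q → Q xs)) ≡ true)
  GSat (¬' φ) v = ¬ GSat φ v
  GSat (φ ∧' ψ) v = GSat φ v × GSat ψ v
  GSat (∀' x φ) v = ∀ (u : UF X) → GSat φ (update v x u)
  GSat (∃' x φ) v = Σ (UF X) λ u → GSat φ (update v x u)

-- the ordinary model e(𝔄) = (βX, e(ι(F)), …, e(ι(R)), …),
-- where eF n, eR n are the continuous extensions e
module OrdSemantics {σ : Signature} {X : Set} (ι : Interp σ X)
    (eF : ∀ n → UF (FunSp X n) → (Fin n → UF X) → UF X)
    (eR : ∀ n → UF (RelSp X n) → (Fin n → UF X) → Bool) where

  oval : (ℕ → UF X) → Term σ → UF X
  oval v (var x) = v x
  oval v (app F ts) = eF (farity σ F) (iF ι F) (λ i → oval v (ts i))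

  OSat : Formula σ → (ℕ → UF X) → Set
  OSat (t₁ ≐ t₂) v = (oval v t₁ ≈ oval v t₂)
  OSat (rel R ts) v = (eR (rarity σ R) (iR ι R) (λ i → oval v (ts i)) ≡ true)
  OSat (¬' φ) v = ¬ OSat φ v
  OSat (φ ∧' ψ) v = OSat φ v × OSat ψ v
  OSat (∀' x φ) v = ∀ (u : UF X) → OSat φ (update v x u)
  OSat (∃' x φ) v = Σ (UF X) λ u → OSat φ (update v x u)

-- A continuous h : βZ → Bool is the limit of its restriction to Z:
-- h u = true exactly when {z : h z = true} ∈ u.  Applying this one argument at
-- a time, a Bool-valued map V on (βX)ᵐ that is right continuous w.r.t. X
-- satisfies V(u₁,…,uₘ) = true iff (∀^{u₁}x₁)⋯(∀^{uₘ}xₘ) V(x₁,…,xₘ) = true,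
-- so V is determined by its values on Xᵐ.  For V(us) = [A ∈ e(𝔣)(us)] these
-- values are, by continuity of e in 𝔣 and e(f) = f̃, those of app̃(us, 𝔣);
-- likewise e(𝔯) agrees with ĩn(·, 𝔯).  Hence both models give every term the
-- same value, and satisfaction agrees by induction on formulas.
module Submission where

open import Defs
open import Data.Nat using (ℕ)
open import Data.Bool using (Bool)
open import Data.Fin using (Fin)
open import Function.Bundles using (_⇔_)

open import Data.Bool using (true; false; not; _∧_) renaming (_≟_ to _≟ᵇ_)
open import Data.Fin using (zero; suc; _<?_)
open import Data.Fin.Properties using () renaming (_≟_ to _≟ᶠ_)
open import Data.Nat using (s≤s)
open import Data.Product using (_,_)
open import Data.Product.Function.NonDependent.Propositional using (_×-⇔_)
open import Data.Product.Function.Dependent.Propositional using (Σ-⇔)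
open import Data.Sum using (inj₁; inj₂)
open import Function using (_∘_)
open import Function.Bundles using (mk⇔; Equivalence)
open import Function.Construct.Identity using (↠-id)
open import Function.Related.TypeIsomorphisms using (¬-cong-⇔)
open import Relation.Nullary using (¬_; yes; no; contradiction)
open import Relation.Nullary.Decidable using (decidable-stable)
open import Relation.Binary.PropositionalEquality

module _ {Z : Set} (u : UF Z) where

  ∅∉ : ¬ mem u (λ _ → false) ≡ true
  ∅∉ p with trans (sym (proper u)) p
  ... | ()

  mem-constantOn : (A B : Z → Bool) {b : Bool} → (∀ z → A z ≡ true → B z ≡ b) →
                   mem u A ≡ true → mem u B ≡ b
  mem-constantOn A B {true} B≡b A∈u = upward u A B B≡b A∈u
  mem-constantOn A B {false} B≡b A∈u with mem u B in B∈u
  ... | false = refl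
  ... | true = contradiction (upward u _ _ A∩B⊆∅ (inter u A B A∈u B∈u)) ∅∉
    where
    A∩B⊆∅ : ∀ z → A z ∧ B z ≡ true → false ≡ true
    A∩B⊆∅ z p with A z in Az
    ... | true = trans (sym (B≡b z Az)) p

  mem-cong : (A B : Z → Bool) → (∀ z → A z ≡ B z) → mem u A ≡ mem u B
  mem-cong A B A≡B with mem u A in A∈u | mem u B in B∈u
  ... | true  | true  = refl
  ... | false | false = refl
  ... | true  | false = trans (sym (upward u A B (λ z → trans (sym (A≡B z))) A∈u)) B∈u
  ... | false | true  = trans (sym A∈u) (upward u B A (λ z → trans (A≡B z)) B∈u)

  inhabited : ¬ ¬ Z
  inhabited ¬z with ultra u (λ _ → false)
  ... | inj₁ ∅∈u = ∅∉ ∅∈u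
  ... | inj₂ Z∈u = ∅∉ (upward u _ _ (λ z → contradiction z ¬z) Z∈u)

IsOpen-mem : {Z : Set} (A : Z → Bool) (b : Bool) → IsOpen (λ w → mem w A ≡ b)
IsOpen-mem A true w A∈w = A , A∈w , λ _ A∈w′ → A∈w′
IsOpen-mem A false w A∉w with ultra w A
... | inj₁ A∈w = contradiction (trans (sym A∉w) A∈w) λ ()
... | inj₂ ∁A∈w = (not ∘ A) , ∁A∈w , λ w′ → mem-constantOn w′ (not ∘ A) A ∁A⊆A≡false
  where
  ∁A⊆A≡false : ∀ z → not (A z) ≡ true → A z ≡ false
  ∁A⊆A≡false z p with A z
  ... | false = refl

IsOpen-cong : {Z : Set} {U V : UF Z → Set} → (∀ u → U u → V u) → (∀ u → V u → U u) →
              IsOpen U → IsOpen V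
IsOpen-cong U⊆V V⊆U U-open u Vu with U-open u (V⊆U u Vu)
... | A , A∈u , A⊆U = A , A∈u , λ w A∈w → U⊆V w (A⊆U w A∈w)

Continuous : {Z : Set} → (UF Z → Bool) → Set
Continuous h = ∀ b → IsOpen (λ u → h u ≡ b)

continuous⇒limit : {Z : Set} (h : UF Z → Bool) → Continuous h →
                   ∀ u → h u ≡ mem u (h ∘ principal)
continuous⇒limit h h-cont u with h-cont (h u) u refl
... | A , A∈u , A⊆h⁻¹ = sym (mem-constantOn u A (h ∘ principal) (A⊆h⁻¹ ∘ principal) A∈u)

mix-zero : {X : Set} {n : ℕ} (a : Fin (ℕ.suc n) → X) (us : Fin (ℕ.suc n) → UF X) (w : UF X) →
           ∀ j → mix zero a us w j ≡ cons w (us ∘ suc) j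
mix-zero a us w zero = refl
mix-zero a us w (suc j) = refl

mix-suc : {X : Set} {n : ℕ} (i : Fin n) (x : X) (a : Fin n → X) (ws : Fin n → UF X) (w : UF X) →
          ∀ j → mix (suc i) (cons x a) (cons (principal x) ws) w j ≡ cons (principal x) (mix i a ws w) j
mix-suc i x a ws w zero = refl
mix-suc i x a ws w (suc j) with suc j <? suc i | j <? i
... | yes _          | yes _ = refl
... | yes (s≤s j<i)  | no j≮i = contradiction j<i j≮i
... | no sj≮si       | yes j<i = contradiction (s≤s j<i) sj≮si
... | no _           | no _ with j ≟ᶠ i
...   | yes _ = refl
...   | no _ = refl

module _ {X : Set} where

  infix 4 _≋_

  _≋_ : {m : ℕ} → (Fin m → UF X) → (Fin m → UF X) → Set
  us ≋ ws = ∀ i → us i ≈ ws i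

  Respects≋ : (m : ℕ) → ((Fin m → UF X) → Bool) → Set
  Respects≋ m V = ∀ us ws → us ≋ ws → V us ≡ V ws

  RightContinuousᵇ : (m : ℕ) → ((Fin m → UF X) → Bool) → Set
  RightContinuousᵇ m V = ∀ i a ws → Continuous (λ w → V (mix i a ws w))

  ≡⇒≋ : {m : ℕ} {us ws : Fin m → UF X} → (∀ i → us i ≡ ws i) → us ≋ ws
  ≡⇒≋ us≡ws i A = cong (λ w → mem w A) (us≡ws i)

  cons-cong : {m : ℕ} {u : UF X} {us ws : Fin m → UF X} → us ≋ ws → cons u us ≋ cons u ws
  cons-cong us≋ws zero A = refl
  cons-cong us≋ws (suc i) = us≋ws i

  cons-head-tail : {m : ℕ} (us : Fin (ℕ.suc m) → UF X) → cons (us zero) (us ∘ suc) ≋ us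
  cons-head-tail us zero A = refl
  cons-head-tail us (suc i) A = refl

  cons-principal : {m : ℕ} (x : X) (b : Fin m → X) →
                   cons (principal x) (principal ∘ b) ≋ principal ∘ cons x b
  cons-principal x b zero A = refl
  cons-principal x b (suc i) A = refl

  module _ {m : ℕ} {V : (Fin (ℕ.suc m) → UF X) → Bool}
           (V-resp : Respects≋ (ℕ.suc m) V) (V-rc : RightContinuousᵇ (ℕ.suc m) V) where

    rightContinuous-head : ∀ u ws → V (cons u ws) ≡ mem u (λ x → V (cons (principal x) ws))
    rightContinuous-head u ws = decidable-stable (_ ≟ᵇ _) λ ≢ → inhabited u λ x → ≢ (viaMix x)
      where
      -- mix at position zero still asks for a point of X (which it ignores); ¬¬ X is
      -- enough since the goal is a decidable equation.
      viaMix : X → V (cons u ws) ≡ mem u (λ x → V (cons (principal x) ws))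
      viaMix x = begin
        V (cons u ws)                          ≡⟨ V-resp _ _ (≡⇒≋ (mix-zero a us u)) ⟨
        h u                                    ≡⟨ continuous⇒limit h (V-rc zero a us) u ⟩
        mem u (h ∘ principal)                  ≡⟨ mem-cong u _ _ (λ z → V-resp _ _ (≡⇒≋ (mix-zero a us (principal z)))) ⟩
        mem u (λ z → V (cons (principal z) ws)) ∎
        where
        open ≡-Reasoning
        a : Fin (ℕ.suc m) → X
        a _ = x
        us : Fin (ℕ.suc m) → UF X
        us = cons u ws
        h : UF X → Bool
        h w = V (mix zero a us w)

    respects-tail : ∀ x → Respects≋ m (V ∘ cons (principal x))
    respects-tail x _ _ us≋ws = V-resp _ _ (cons-cong us≋ws)

    rightContinuous-tail : ∀ x → RightContinuousᵇ m (V ∘ cons (principal x))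
    rightContinuous-tail x i a ws b =
      IsOpen-cong (λ w → trans (sym (shift w))) (λ w → trans (shift w))
        (V-rc (suc i) (cons x a) (cons (principal x) ws) b)
      where
      shift : ∀ w → V (mix (suc i) (cons x a) (cons (principal x) ws) w) ≡
                    V (cons (principal x) (mix i a ws w))
      shift w = V-resp _ _ (≡⇒≋ (mix-suc i x a ws w))

  rightContinuous⇒iter : ∀ m {V : (Fin m → UF X) → Bool} → Respects≋ m V → RightContinuousᵇ m V →
    (P : (Fin m → X) → Bool) → (∀ b → V (principal ∘ b) ≡ iter m (principal ∘ b) P) →
    ∀ us → V us ≡ iter m us P
  rightContinuous⇒iter ℕ.zero V-resp V-rc P onX us = trans (V-resp _ _ λ ()) (onX λ ())
  rightContinuous⇒iter (ℕ.suc m) {V} V-resp V-rc P onX us = begin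
    V us                                                  ≡⟨ V-resp _ _ (cons-head-tail us) ⟨
    V (cons (us zero) (us ∘ suc))                         ≡⟨ rightContinuous-head V-resp V-rc (us zero) (us ∘ suc) ⟩
    mem (us zero) (λ x → V (cons (principal x) (us ∘ suc))) ≡⟨ mem-cong (us zero) _ _ tail≡iter ⟩
    iter (ℕ.suc m) us P                                   ∎
    where
    open ≡-Reasoning
    tail≡iter : ∀ x → V (cons (principal x) (us ∘ suc)) ≡ iter m (us ∘ suc) (P ∘ cons x)
    tail≡iter x = rightContinuous⇒iter m (respects-tail V-resp V-rc x) (rightContinuous-tail V-resp V-rc x)
      (P ∘ cons x) (λ b → trans (V-resp _ _ (cons-principal x b)) (onX (cons x b))) (us ∘ suc)

  iterM-cong : ∀ n (ms : Fin n → (X → Bool) → Bool) (ws : Fin n → UF X) →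
               (∀ i B → ms i B ≡ mem (ws i) B) → ∀ P → iterM n ms P ≡ iter n ws P
  iterM-cong ℕ.zero ms ws ms≡ws P = refl
  iterM-cong (ℕ.suc n) ms ws ms≡ws P = trans (ms≡ws zero _) (mem-cong (ws zero) _ _ λ x →
    iterM-cong n (ms ∘ suc) (ws ∘ suc) (ms≡ws ∘ suc) (P ∘ cons x))

  mem-iter-principal : {Z : Set} (n : ℕ) (b : Fin n → X) (𝔣 : UF Z) (R : (Fin n → X) → Z → Bool) →
    mem 𝔣 (λ f → iter n (principal ∘ b) (λ xs → R xs f)) ≡ iter n (principal ∘ b) (mem 𝔣 ∘ R)
  mem-iter-principal ℕ.zero b 𝔣 R = refl
  mem-iter-principal (ℕ.suc n) b 𝔣 R = mem-iter-principal n (b ∘ suc) 𝔣 (R ∘ cons (b zero))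

  module _ {n : ℕ} {E : UF (FunSp X n) → (Fin n → UF X) → UF X} (E-ext : IsFunExt X n E) where
    open IsFunExt E-ext

    isFunExt-principal : ∀ 𝔣 b A →
      mem (E 𝔣 (principal ∘ b)) A ≡ iter n (principal ∘ b) (λ xs → mem 𝔣 (λ f → A (f xs)))
    isFunExt-principal 𝔣 b A = begin
      mem (E 𝔣 (principal ∘ b)) A                                   ≡⟨ continuous⇒limit _ E-cont 𝔣 ⟩
      mem 𝔣 (λ f → mem (E (principal f) (principal ∘ b)) A)         ≡⟨ mem-cong 𝔣 _ _ (λ f → extends f _ A) ⟩
      mem 𝔣 (λ f → iter n (principal ∘ b) (λ xs → A (f xs)))        ≡⟨ mem-iter-principal n b 𝔣 _ ⟩
      iter n (principal ∘ b) (λ xs → mem 𝔣 (λ f → A (f xs)))        ∎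
      where
      open ≡-Reasoning
      E-cont : Continuous (λ 𝔤 → mem (E 𝔤 (principal ∘ b)) A)
      E-cont c = cont b _ (IsOpen-mem A c)

    isFunExt-app : ∀ 𝔣 ws A → mem (E 𝔣 ws) A ≡ iter n ws (λ xs → mem 𝔣 (λ f → A (f xs)))
    isFunExt-app 𝔣 ws A = rightContinuous⇒iter n (λ us ws us≋ws → resp-arg 𝔣 us ws us≋ws A)
      (λ i a vs c → rc 𝔣 i a vs _ (IsOpen-mem A c)) _ (λ b → isFunExt-principal 𝔣 b A) ws

  module _ {n : ℕ} {E : UF (RelSp X n) → (Fin n → UF X) → Bool} (E-ext : IsRelExt X n E) where
    open IsRelExt E-ext

    isRelExt-principal : ∀ 𝔯 b → E 𝔯 (principal ∘ b) ≡ iter n (principal ∘ b) (λ xs → mem 𝔯 (λ Q → Q xs))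
    isRelExt-principal 𝔯 b = begin
      E 𝔯 (principal ∘ b)                                 ≡⟨ continuous⇒limit _ (λ c → cont b (_≡ c)) 𝔯 ⟩
      mem 𝔯 (λ Q → E (principal Q) (principal ∘ b))      ≡⟨ mem-cong 𝔯 _ _ (λ Q → extends Q _) ⟩
      mem 𝔯 (λ Q → iter n (principal ∘ b) Q)             ≡⟨ mem-iter-principal n b 𝔯 _ ⟩
      iter n (principal ∘ b) (λ xs → mem 𝔯 (λ Q → Q xs)) ∎
      where open ≡-Reasoning

    isRelExt-in : ∀ 𝔯 ws → E 𝔯 ws ≡ iter n ws (λ xs → mem 𝔯 (λ Q → Q xs))
    isRelExt-in 𝔯 = rightContinuous⇒iter n (resp-arg 𝔯) (λ i a vs c → rc 𝔯 i a vs (_≡ c)) _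
      (isRelExt-principal 𝔯)

module _ {σ : Signature} {X : Set} (ι : Interp σ X)
    (eF : ∀ n → UF (FunSp X n) → (Fin n → UF X) → UF X)
    (eR : ∀ n → UF (RelSp X n) → (Fin n → UF X) → Bool)
    (eF-ext : ∀ n → IsFunExt X n (eF n))
    (eR-ext : ∀ n → IsRelExt X n (eR n)) where
  open Semantics ι
  open OrdSemantics ι eF eR

  gval≡oval : ∀ t v A → gval v t A ≡ mem (oval v t) A
  gval≡oval (var x) v A = refl
  gval≡oval (app F ts) v A = trans
    (iterM-cong _ (λ i → gval v (ts i)) (λ i → oval v (ts i)) (λ i → gval≡oval (ts i) v) _)
    (sym (isFunExt-app (eF-ext (farity σ F)) (iF ι F) _ A))

  GSat⇔OSat : ∀ φ v → GSat φ v ⇔ OSat φ v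
  GSat⇔OSat (t₁ ≐ t₂) v = mk⇔
    (λ t₁≡t₂ A → trans (sym (gval≡oval t₁ v A)) (trans (t₁≡t₂ A) (gval≡oval t₂ v A)))
    (λ t₁≈t₂ A → trans (gval≡oval t₁ v A) (trans (t₁≈t₂ A) (sym (gval≡oval t₂ v A))))
  GSat⇔OSat (rel R ts) v = mk⇔ (trans (sym in≡eR)) (trans in≡eR)
    where
    in≡eR : iterM (rarity σ R) (λ i → gval v (ts i)) (λ xs → mem (iR ι R) (λ Q → Q xs)) ≡
            eR (rarity σ R) (iR ι R) (λ i → oval v (ts i))
    in≡eR = trans (iterM-cong _ (λ i → gval v (ts i)) (λ i → oval v (ts i)) (λ i → gval≡oval (ts i) v) _)
                  (sym (isRelExt-in (eR-ext (rarity σ R)) (iR ι R) _))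
  GSat⇔OSat (¬' φ) v = ¬-cong-⇔ (GSat⇔OSat φ v)
  GSat⇔OSat (φ ∧' ψ) v = GSat⇔OSat φ v ×-⇔ GSat⇔OSat ψ v
  GSat⇔OSat (∀' x φ) v = mk⇔
    (λ h u → Equivalence.to (GSat⇔OSat φ (update v x u)) (h u))
    (λ h u → Equivalence.from (GSat⇔OSat φ (update v x u)) (h u))
  GSat⇔OSat (∃' x φ) v = Σ-⇔ (↠-id _) λ {u} → GSat⇔OSat φ (update v x u)

theorem23 : (σ : Signature) (X : Set) (ι : Interp σ X)
    (eF : ∀ n → UF (FunSp X n) → (Fin n → UF X) → UF X)
    (eR : ∀ n → UF (RelSp X n) → (Fin n → UF X) → Bool)
    (eF-ext : ∀ n → IsFunExt X n (eF n))
    (eR-ext : ∀ n → IsRelExt X n (eR n))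
    (φ : Formula σ) (v : ℕ → UF X) →
    Semantics.GSat ι φ v ⇔ OrdSemantics.OSat ι eF eR φ v
theorem23 σ X ι eF eR eF-ext eR-ext = GSat⇔OSat ι eF eR eF-ext eR-ext
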